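{- Let $A$ be an $n\times n$ skew-symmetric (real or complex) matrix. If $X\subseteq[n]$ is an HL-clan of $A$, then $\det(Inv(X,A))=\det(A)$.
   Context: $[n]=\{1,\dots,n\}$, $\overline{X}=[n]\setminus X$; $A[X,Y]$ is the submatrix of $A$ with rows in $X$ and columns in $Y$. A subset $X\subseteq[n]$ is an HL-clan of $A$ if both $A[X,\overline{X}]$ and $A[\overline{X},X]$ have rank at most $1$ ($\emptyset$, $[n]$ and singletons are HL-clans). For skew-symmetric $A=[a_{ij}]$ and $X\subseteq[n]$, $Inv(X,A)=[t_{ij}]$ with $t_{ij}=-a_{ij}$ if $i,j\in X$ and $t_{ij}=a_{ij}$ otherwise. -}

module Defs where

open import Level using (Level; _⊔_)
open import Data.Nat using (ℕ; zero; suc)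
open import Data.Fin using (Fin; zero; suc; punchIn)
open import Data.Fin.Subset using (Subset; _∈_; _∉_)
open import Data.Vec using (lookup)
open import Data.Bool using (Bool; true; false; if_then_else_; _∧_)
open import Data.Product using (Σ; ∃; _×_; _,_)
open import Relation.Nullary using (¬_)
open import Algebra.Bundles using (CommutativeRing)

record Field (c ℓ : Level) : Set (Level.suc (c ⊔ ℓ)) where
  field
    commutativeRing : CommutativeRing c ℓ
  open CommutativeRing commutativeRing public
  field
    1≉0     : ¬ (1# ≈ 0#)
    inverse : ∀ x → ¬ (x ≈ 0#) → ∃ λ y → x * y ≈ 1#

module _ {c ℓ : Level} (F : Field c ℓ) where
  open Field F using (Carrier; _≈_; _+_; _*_; -_; 0#; 1#)

  -- n × n matrices over F, indexed by Fin n (rows/columns 0..n-1 ≙ 1..n).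
  Matrix : ℕ → Set c
  Matrix n = Fin n → Fin n → Carrier

  SkewSymmetric : ∀ {n} → Matrix n → Set ℓ
  SkewSymmetric A = ∀ i j → A j i ≈ - A i j

  Σ[_] : ∀ n → (Fin n → Carrier) → Carrier
  Σ[ zero ] f = 0#
  Σ[ suc n ] f = f zero + Σ[ n ] (λ i → f (suc i))

  signed : ∀ {n} → Fin n → Carrier → Carrier
  signed zero x = x
  signed (suc j) x = - signed j x

  det : ∀ n → Matrix n → Carrier
  det zero A = 1#
  det (suc n) A =
    Σ[ suc n ] (λ j → signed j (A zero j * det n (λ r s → A (suc r) (punchIn j s))))

  -- A[X,Y] has rank at most 1  iff  it factors as u vᵀ (rows in X, columns in Y).
  RankAtMostOne : ∀ {n} → Matrix n → (Fin n → Set) → (Fin n → Set) → Set (c ⊔ ℓ)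
  RankAtMostOne {n} A X Y =
    Σ (Fin n → Carrier) λ u → Σ (Fin n → Carrier) λ v →
      ∀ i j → X i → Y j → A i j ≈ u i * v j

  HLClan : ∀ {n} → Matrix n → Subset n → Set (c ⊔ ℓ)
  HLClan A X =
    RankAtMostOne A (_∈ X) (_∉ X) × RankAtMostOne A (_∉ X) (_∈ X)

  Inv : ∀ {n} → Subset n → Matrix n → Matrix n
  Inv X A i j = if lookup X i ∧ lookup X j then - A i j else A i j

{-# OPTIONS --safe #-}
-- For M = [[a, bᵀ], [c, D]] one has det M = (a + 1) det D − det (D + c bᵀ): split the first
-- column as (a + 1, 0) + (−1, c) and clear the first row of the second summand by column
-- operations, which leaves −det (D + c bᵀ).
--
-- Call N a block transpose of M along X if N[X,X] = M[X,X]ᵀ, N[X̄,X̄] = M[X̄,X̄] and the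
-- off-diagonal blocks factor as M[X,X̄] = p vᵀ, N[X,X̄] = q vᵀ, M[X̄,X] = w qᵀ, N[X̄,X] = w pᵀ.
-- This relation passes from (M, N) both to (D_M, D_N) and to (D_M + c_M b_Mᵀ, D_N + c_N b_Nᵀ),
-- with updated factors, so det N = det M by induction on the size. For skew-symmetric A and an
-- HL-clan X with A[X,X̄] = u vᵀ, Inv(X,A) is a block transpose of A with p = q = u and w = −v,
-- because −A[X,X] = A[X,X]ᵀ and A[X̄,X] = −(u vᵀ)ᵀ.
module Submission where

open import Defs
open import Level using (Level; _⊔_)
open import Data.Nat using (ℕ; zero; suc; _≤_; z≤n)
open import Data.Nat.Properties using (≤-refl; ≤∧≢⇒<; <⇒≤; <⇒≱)
open import Data.Fin using (Fin; zero; suc; toℕ; inject₁; punchIn; punchOut; fromℕ<)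
open import Data.Fin.Properties
  using (punchIn-injective; punchInᵢ≢i; punchIn-punchOut; suc-injective; toℕ-fromℕ<; toℕ<n; toℕ-injective)
  renaming (_≟_ to _≟ᶠ_)
open import Data.Fin.Induction using (<-weakInduction)
open import Data.Fin.Subset using (Subset; _∈_; _∉_; inside; outside)
open import Data.Fin.Subset.Properties using (drop-there)
open import Data.Bool.Properties using (∧-zeroʳ)
open import Data.Vec using (_∷_; lookup; here; there)
open import Data.Vec.Properties using (lookup⇒[]=; []=⇒lookup)
open import Data.Vec.Functional using (updateAt)
open import Data.Vec.Functional.Properties
  using (updateAt-updates; updateAt-minimal; updateAt-commutes; updateAt-id-local)
open import Data.Product using (∃; _×_; _,_)
open import Data.Sum using (_⊎_; inj₁; inj₂)
open import Function using (_∘_)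
open import Relation.Nullary using (yes; no; contradiction)
import Relation.Binary.PropositionalEquality as ≡
open ≡ using (_≡_; _≢_)

inject₁≢suc : ∀ {n} (i : Fin n) → inject₁ i ≢ suc i
inject₁≢suc zero    ()
inject₁≢suc (suc i) eq = inject₁≢suc i (suc-injective eq)

punchIn-adjacent : ∀ {m} (i : Fin (suc m)) (j : Fin (suc (suc m))) → j ≢ inject₁ i → j ≢ suc i →
                   ∃ λ i′ → punchIn j (inject₁ i′) ≡ inject₁ i × punchIn j (suc i′) ≡ suc i
punchIn-adjacent         zero    zero          j≢ _   = contradiction ≡.refl j≢
punchIn-adjacent         zero    (suc zero)    _  j≢′ = contradiction ≡.refl j≢′
punchIn-adjacent {suc m} zero    (suc (suc j)) _  _   = zero , ≡.refl , ≡.refl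
punchIn-adjacent {suc m} (suc i) zero          _  _   = i , ≡.refl , ≡.refl
punchIn-adjacent {suc m} (suc i) (suc j)       j≢ j≢′
  with i′ , e₁ , e₂ ← punchIn-adjacent i j (j≢ ∘ ≡.cong suc) (j≢′ ∘ ≡.cong suc)
  = suc i′ , ≡.cong suc e₁ , ≡.cong suc e₂

punchIn-inject₁-suc : ∀ {m} (i : Fin m) s →
                      punchIn (inject₁ i) s ≡ punchIn (suc i) s ⊎
                      (punchIn (inject₁ i) s ≡ suc i × punchIn (suc i) s ≡ inject₁ i)
punchIn-inject₁-suc zero    zero    = inj₂ (≡.refl , ≡.refl)
punchIn-inject₁-suc zero    (suc s) = inj₁ ≡.refl
punchIn-inject₁-suc (suc i) zero    = inj₁ ≡.refl
punchIn-inject₁-suc (suc i) (suc s) with punchIn-inject₁-suc i s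
... | inj₁ e         = inj₁ (≡.cong suc e)
... | inj₂ (e₁ , e₂) = inj₂ (≡.cong suc e₁ , ≡.cong suc e₂)

lookup-∉ : ∀ {n} {X : Subset n} {r} → r ∉ X → lookup X r ≡ outside
lookup-∉ {X = X} {r} r∉X with lookup X r in eq
... | inside  = contradiction (lookup⇒[]= r X eq) r∉X
... | outside = ≡.refl

module Determinant {c ℓ : Level} (F : Field c ℓ) where
  open Field F hiding (zero)
  open import Algebra.Properties.Ring ring
    using (-‿distribʳ-*; -‿+-comm; -‿involutive; -0#≈0#; -1*x≈-x; +-inverseʳ-unique; x+x≈x⇒x≈0)
  open import Algebra.Solver.Ring.NaturalCoefficients.Default commutativeSemiring
  open import Relation.Binary.Reasoning.Setoid setoid

  private
    Mat : ℕ → Set c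
    Mat = Matrix F

  ∑ : ∀ n → (Fin n → Carrier) → Carrier
  ∑ = Σ[_] F

  ∑-cong : ∀ n {f g : Fin n → Carrier} → (∀ i → f i ≈ g i) → ∑ n f ≈ ∑ n g
  ∑-cong zero    f≈g = refl
  ∑-cong (suc n) f≈g = +-cong (f≈g zero) (∑-cong n (f≈g ∘ suc))

  ∑-linear : ∀ n a (f g : Fin n → Carrier) → ∑ n (λ i → a * f i + g i) ≈ a * ∑ n f + ∑ n g
  ∑-linear zero    a f g = solve 1 (λ a → con 0 := a :* con 0 :+ con 0) refl a
  ∑-linear (suc n) a f g = begin
    (a * f zero + g zero) + ∑ n (λ i → a * f (suc i) + g (suc i))
      ≈⟨ +-cong refl (∑-linear n a (f ∘ suc) (g ∘ suc)) ⟩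
    (a * f zero + g zero) + (a * ∑ n (f ∘ suc) + ∑ n (g ∘ suc))
      ≈⟨ solve 5 (λ a x y X Y → (a :* x :+ y) :+ (a :* X :+ Y) := a :* (x :+ X) :+ (y :+ Y))
               refl a (f zero) (g zero) (∑ n (f ∘ suc)) (∑ n (g ∘ suc)) ⟩
    a * (f zero + ∑ n (f ∘ suc)) + (g zero + ∑ n (g ∘ suc)) ∎

  ∑-zero : ∀ n {f : Fin n → Carrier} → (∀ i → f i ≈ 0#) → ∑ n f ≈ 0#
  ∑-zero zero    f≈0 = refl
  ∑-zero (suc n) f≈0 = trans (+-cong (f≈0 zero) (∑-zero n (f≈0 ∘ suc))) (+-identityˡ 0#)

  ∑-head : ∀ n {f : Fin (suc n) → Carrier} → (∀ i → f (suc i) ≈ 0#) → ∑ (suc n) f ≈ f zero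
  ∑-head n {f} tail≈0 = trans (+-cong refl (∑-zero n tail≈0)) (+-identityʳ (f zero))

  ∑-adjacentPair : ∀ {n} (i : Fin n) (f : Fin (suc n) → Carrier) →
                   (∀ j → j ≢ inject₁ i → j ≢ suc i → f j ≈ 0#) →
                   f (inject₁ i) + f (suc i) ≈ 0# → ∑ (suc n) f ≈ 0#
  ∑-adjacentPair {suc n} zero f rest≈0 pair≈0 = begin
    f zero + (f (suc zero) + ∑ n (λ j → f (suc (suc j))))
      ≈⟨ +-cong refl (+-cong refl (∑-zero n (λ j → rest≈0 (suc (suc j)) (λ ()) (λ ())))) ⟩
    f zero + (f (suc zero) + 0#)  ≈⟨ +-cong refl (+-identityʳ _) ⟩
    f zero + f (suc zero)         ≈⟨ pair≈0 ⟩
    0#                            ∎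
  ∑-adjacentPair {suc n} (suc i) f rest≈0 pair≈0 = begin
    f zero + ∑ (suc n) (f ∘ suc)
      ≈⟨ +-cong (rest≈0 zero (λ ()) (λ ()))
                (∑-adjacentPair i (f ∘ suc)
                  (λ j j≢ j≢′ → rest≈0 (suc j) (j≢ ∘ suc-injective) (j≢′ ∘ suc-injective)) pair≈0) ⟩
    0# + 0#  ≈⟨ +-identityˡ 0# ⟩
    0#       ∎

  signed-cong : ∀ {n} (j : Fin n) {x y} → x ≈ y → signed F j x ≈ signed F j y
  signed-cong zero    x≈y = x≈y
  signed-cong (suc j) x≈y = -‿cong (signed-cong j x≈y)

  signed-linear : ∀ {n} (j : Fin n) a x y → signed F j (a * x + y) ≈ a * signed F j x + signed F j y
  signed-linear zero    a x y = refl
  signed-linear (suc j) a x y = begin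
    - signed F j (a * x + y)                ≈⟨ -‿cong (signed-linear j a x y) ⟩
    - (a * signed F j x + signed F j y)     ≈⟨ -‿+-comm _ _ ⟨
    - (a * signed F j x) + - signed F j y   ≈⟨ +-cong (-‿distribʳ-* a _) refl ⟩
    a * - signed F j x + - signed F j y     ∎

  signed-zero : ∀ {n} (j : Fin n) → signed F j 0# ≈ 0#
  signed-zero zero    = refl
  signed-zero (suc j) = trans (-‿cong (signed-zero j)) -0#≈0#

  signed-inject₁ : ∀ {n} (i : Fin n) x → signed F (inject₁ i) x ≡ signed F i x
  signed-inject₁ zero    x = ≡.refl
  signed-inject₁ (suc i) x = ≡.cong -_ (signed-inject₁ i x)

  minor : ∀ {n} → Fin (suc n) → Mat (suc n) → Mat n
  minor j M r s = M (suc r) (punchIn j s)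

  expansionTerm : ∀ {n} → Mat (suc n) → Fin (suc n) → Carrier
  expansionTerm {n} M j = signed F j (M zero j * det F n (minor j M))

  det-cong : ∀ n {M N : Mat n} → (∀ r s → M r s ≈ N r s) → det F n M ≈ det F n N
  det-cong zero    M≈N = refl
  det-cong (suc n) M≈N = ∑-cong (suc n) λ j →
    signed-cong j (*-cong (M≈N zero j) (det-cong n (λ r s → M≈N (suc r) (punchIn j s))))

  det-linear : ∀ n (k : Fin n) a {M N P : Mat n} →
               (∀ r → P r k ≈ a * M r k + N r k) →
               (∀ r s → s ≢ k → P r s ≈ M r s) →
               (∀ r s → s ≢ k → P r s ≈ N r s) →
               det F n P ≈ a * det F n M + det F n N
  det-linear (suc n) k a {M} {N} {P} Pₖ P≈M P≈N =
    trans (∑-cong (suc n) term) (∑-linear (suc n) a (expansionTerm M) (expansionTerm N))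
    where
    term : ∀ j → expansionTerm P j ≈ a * expansionTerm M j + expansionTerm N j
    term j with j ≟ᶠ k
    ... | yes ≡.refl = begin
      signed F j (P zero j * det F n (minor j P))
        ≈⟨ signed-cong j (*-cong (Pₖ zero) refl) ⟩
      signed F j ((a * M zero j + N zero j) * det F n (minor j P))
        ≈⟨ signed-cong j (solve 4 (λ a x y d → (a :* x :+ y) :* d := a :* (x :* d) :+ y :* d)
                                  refl a (M zero j) (N zero j) (det F n (minor j P))) ⟩
      signed F j (a * (M zero j * det F n (minor j P)) + N zero j * det F n (minor j P))
        ≈⟨ signed-linear j a _ _ ⟩
      a * signed F j (M zero j * det F n (minor j P)) + signed F j (N zero j * det F n (minor j P))
        ≈⟨ +-cong (*-cong refl (signed-cong j (*-cong refl (det-cong n (minor-off P≈M)))))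
                  (signed-cong j (*-cong refl (det-cong n (minor-off P≈N)))) ⟩
      a * expansionTerm M j + expansionTerm N j ∎
      where
      minor-off : ∀ {Q} → (∀ r s → s ≢ k → P r s ≈ Q r s) → ∀ r s → minor j P r s ≈ minor j Q r s
      minor-off P≈Q r s = P≈Q (suc r) (punchIn j s) (punchInᵢ≢i j s)
    ... | no j≢k = begin
      signed F j (P zero j * det F n (minor j P))
        ≈⟨ signed-cong j (*-cong refl minor-linear) ⟩
      signed F j (P zero j * (a * det F n (minor j M) + det F n (minor j N)))
        ≈⟨ signed-cong j (solve 4 (λ p a x y → p :* (a :* x :+ y) := a :* (p :* x) :+ p :* y)
                                  refl (P zero j) a (det F n (minor j M)) (det F n (minor j N))) ⟩
      signed F j (a * (P zero j * det F n (minor j M)) + P zero j * det F n (minor j N))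
        ≈⟨ signed-linear j a _ _ ⟩
      a * signed F j (P zero j * det F n (minor j M)) + signed F j (P zero j * det F n (minor j N))
        ≈⟨ +-cong (*-cong refl (signed-cong j (*-cong (P≈M zero j j≢k) refl)))
                  (signed-cong j (*-cong (P≈N zero j j≢k) refl)) ⟩
      a * expansionTerm M j + expansionTerm N j ∎
      where
      k′ : Fin n
      k′ = punchOut j≢k

      off-k′ : ∀ s → s ≢ k′ → punchIn j s ≢ k
      off-k′ s s≢k′ eq = s≢k′ (punchIn-injective j s k′ (≡.trans eq (≡.sym (punchIn-punchOut j≢k))))

      minor-linear : det F n (minor j P) ≈ a * det F n (minor j M) + det F n (minor j N)
      minor-linear = det-linear n k′ a
        (λ r → ≡.subst (λ t → P (suc r) t ≈ a * M (suc r) t + N (suc r) t)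
                       (≡.sym (punchIn-punchOut j≢k)) (Pₖ (suc r)))
        (λ r s s≢k′ → P≈M (suc r) (punchIn j s) (off-k′ s s≢k′))
        (λ r s s≢k′ → P≈N (suc r) (punchIn j s) (off-k′ s s≢k′))

  det-additive : ∀ n (k : Fin n) {M N P : Mat n} →
                 (∀ r → P r k ≈ M r k + N r k) →
                 (∀ r s → s ≢ k → P r s ≈ M r s) →
                 (∀ r s → s ≢ k → P r s ≈ N r s) →
                 det F n P ≈ det F n M + det F n N
  det-additive n k Pₖ P≈M P≈N =
    trans (det-linear n k 1# (λ r → trans (Pₖ r) (+-cong (sym (*-identityˡ _)) refl)) P≈M P≈N)
          (+-cong (*-identityˡ _) refl)

  det-zeroColumn : ∀ n (k : Fin n) (M : Mat n) → (∀ r → M r k ≈ 0#) → det F n M ≈ 0#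
  det-zeroColumn n k M Mₖ≈0 =
    x+x≈x⇒x≈0 (det F n M) (sym (det-additive n k Mₖ≈0+0 (λ _ _ _ → refl) (λ _ _ _ → refl)))
    where
    Mₖ≈0+0 : ∀ r → M r k ≈ M r k + M r k
    Mₖ≈0+0 r = trans (Mₖ≈0 r) (trans (sym (+-identityʳ 0#)) (sym (+-cong (Mₖ≈0 r) (Mₖ≈0 r))))

  det-adjacentEqualColumns : ∀ n (i : Fin n) (M : Mat (suc n)) →
                             (∀ r → M r (inject₁ i) ≈ M r (suc i)) → det F (suc n) M ≈ 0#
  det-adjacentEqualColumns (suc m) i M cols≈ = ∑-adjacentPair i (expansionTerm M) others≈0 pair≈0
    where
    others≈0 : ∀ j → j ≢ inject₁ i → j ≢ suc i → expansionTerm M j ≈ 0#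
    others≈0 j j≢ j≢′ with i′ , e₁ , e₂ ← punchIn-adjacent i j j≢ j≢′ = begin
      expansionTerm M j
        ≈⟨ signed-cong j (*-cong refl (det-adjacentEqualColumns m i′ (minor j M) λ r →
             ≡.subst₂ (λ u v → M (suc r) u ≈ M (suc r) v) (≡.sym e₁) (≡.sym e₂) (cols≈ (suc r)))) ⟩
      signed F j (M zero j * 0#)  ≈⟨ signed-cong j (zeroʳ _) ⟩
      signed F j 0#               ≈⟨ signed-zero j ⟩
      0#                          ∎

    minors≈ : ∀ r s → minor (inject₁ i) M r s ≈ minor (suc i) M r s
    minors≈ r s with punchIn-inject₁-suc i s
    ... | inj₁ e         = reflexive (≡.cong (M (suc r)) e)
    ... | inj₂ (e₁ , e₂) =
      ≡.subst₂ (λ u v → M (suc r) u ≈ M (suc r) v) (≡.sym e₁) (≡.sym e₂) (sym (cols≈ (suc r)))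

    pair≈0 : expansionTerm M (inject₁ i) + expansionTerm M (suc i) ≈ 0#
    pair≈0 = begin
      expansionTerm M (inject₁ i) + - x
        ≈⟨ +-cong (reflexive (signed-inject₁ i _)) refl ⟩
      signed F i (M zero (inject₁ i) * det F (suc m) (minor (inject₁ i) M)) + - x
        ≈⟨ +-cong (signed-cong i (*-cong (cols≈ zero) (det-cong (suc m) minors≈))) refl ⟩
      x + - x  ≈⟨ -‿inverseʳ x ⟩
      0#       ∎
      where
      x : Carrier
      x = signed F i (M zero (suc i) * det F (suc m) (minor (suc i) M))

  column : ∀ {n} → Mat n → Fin n → Fin n → Carrier
  column M k r = M r k

  replaceColumn : ∀ {n} → Mat n → Fin n → (Fin n → Carrier) → Mat n
  replaceColumn M k x r = updateAt (M r) k (λ _ → x r)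

  det-replaceColumn-additive : ∀ n (M : Mat n) k (x y : Fin n → Carrier) →
    det F n (replaceColumn M k (λ r → x r + y r)) ≈
    det F n (replaceColumn M k x) + det F n (replaceColumn M k y)
  det-replaceColumn-additive n M k x y = det-additive n k new off off
    where
    new : ∀ r → replaceColumn M k (λ r → x r + y r) r k ≈
                replaceColumn M k x r k + replaceColumn M k y r k
    new r = reflexive (≡.trans (updateAt-updates k (M r))
                               (≡.sym (≡.cong₂ _+_ (updateAt-updates k (M r)) (updateAt-updates k (M r)))))

    off : ∀ {x′ y′ : Fin n → Carrier} r s → s ≢ k → replaceColumn M k x′ r s ≈ replaceColumn M k y′ r s
    off r s s≢k =
      reflexive (≡.trans (updateAt-minimal s k (M r) s≢k) (≡.sym (updateAt-minimal s k (M r) s≢k)))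

  alternating⇒antisymmetric : ∀ {a} {A : Set a} (_⊕_ : A → A → A) (f : A → A → Carrier) →
                              (∀ x y z → f (x ⊕ y) z ≈ f x z + f y z) →
                              (∀ x y z → f x (y ⊕ z) ≈ f x y + f x z) →
                              (∀ x → f x x ≈ 0#) →
                              ∀ x y → f x y + f y x ≈ 0#
  alternating⇒antisymmetric _⊕_ f additiveˡ additiveʳ alternating x y = begin
    f x y + f y x                          ≈⟨ +-cong (+-identityˡ _) (+-identityʳ _) ⟨
    (0# + f x y) + (f y x + 0#)            ≈⟨ +-cong (+-cong (alternating x) refl) (+-cong refl (alternating y)) ⟨
    (f x x + f x y) + (f y x + f y y)      ≈⟨ +-cong (additiveʳ x x y) (additiveʳ y x y) ⟨
    f x (x ⊕ y) + f y (x ⊕ y)              ≈⟨ additiveˡ x y (x ⊕ y) ⟨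
    f (x ⊕ y) (x ⊕ y)                      ≈⟨ alternating (x ⊕ y) ⟩
    0#                                     ∎

  withAdjacentColumns : ∀ {n} → Mat (suc n) → Fin n → (x y : Fin (suc n) → Carrier) → Mat (suc n)
  withAdjacentColumns M i x y = replaceColumn (replaceColumn M (suc i) y) (inject₁ i) x

  withAdjacentColumns-left : ∀ {n} (M : Mat (suc n)) i x y r → withAdjacentColumns M i x y r (inject₁ i) ≡ x r
  withAdjacentColumns-left M i x y r = updateAt-updates (inject₁ i) (replaceColumn M (suc i) y r)

  withAdjacentColumns-right : ∀ {n} (M : Mat (suc n)) i x y r → withAdjacentColumns M i x y r (suc i) ≡ y r
  withAdjacentColumns-right M i x y r =
    ≡.trans (updateAt-minimal (suc i) (inject₁ i) _ (inject₁≢suc i ∘ ≡.sym)) (updateAt-updates (suc i) (M r))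

  swapAdjacentColumns : ∀ {n} → Mat (suc n) → Fin n → Mat (suc n)
  swapAdjacentColumns M i = withAdjacentColumns M i (column M (suc i)) (column M (inject₁ i))

  det-swapAdjacentColumns : ∀ n (i : Fin n) (M : Mat (suc n)) →
                            det F (suc n) (swapAdjacentColumns M i) ≈ - det F (suc n) M
  det-swapAdjacentColumns n i M = +-inverseʳ-unique _ _ (begin
    det F (suc n) M + f y x  ≈⟨ +-cong (det-cong (suc n) (λ r s → reflexive (unchanged r s))) refl ⟨
    f x y + f y x            ≈⟨ alternating⇒antisymmetric _⊕_ f additiveˡ additiveʳ alternating x y ⟩
    0#                       ∎)
    where
    Col : Set c
    Col = Fin (suc n) → Carrier

    _⊕_ : Col → Col → Col
    (u ⊕ v) r = u r + v r

    x y : Col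
    x = column M (inject₁ i)
    y = column M (suc i)

    f : Col → Col → Carrier
    f u v = det F (suc n) (withAdjacentColumns M i u v)

    commute : ∀ u v r s → withAdjacentColumns M i u v r s ≡
                          replaceColumn (replaceColumn M (inject₁ i) u) (suc i) v r s
    commute u v r = updateAt-commutes (inject₁ i) (suc i) (inject₁≢suc i) (M r)

    additiveˡ : ∀ u v w → f (u ⊕ v) w ≈ f u w + f v w
    additiveˡ u v w = det-replaceColumn-additive (suc n) (replaceColumn M (suc i) w) (inject₁ i) u v

    additiveʳ : ∀ u v w → f u (v ⊕ w) ≈ f u v + f u w
    additiveʳ u v w = begin
      f u (v ⊕ w)
        ≈⟨ det-cong (suc n) (λ r s → reflexive (commute u (v ⊕ w) r s)) ⟩
      det F (suc n) (replaceColumn (replaceColumn M (inject₁ i) u) (suc i) (v ⊕ w))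
        ≈⟨ det-replaceColumn-additive (suc n) (replaceColumn M (inject₁ i) u) (suc i) v w ⟩
      det F (suc n) (replaceColumn (replaceColumn M (inject₁ i) u) (suc i) v) +
      det F (suc n) (replaceColumn (replaceColumn M (inject₁ i) u) (suc i) w)
        ≈⟨ +-cong (det-cong (suc n) (λ r s → reflexive (≡.sym (commute u v r s))))
                  (det-cong (suc n) (λ r s → reflexive (≡.sym (commute u w r s)))) ⟩
      f u v + f u w ∎

    alternating : ∀ u → f u u ≈ 0#
    alternating u = det-adjacentEqualColumns n i (withAdjacentColumns M i u u) λ r →
      reflexive (≡.trans (withAdjacentColumns-left M i u u r) (≡.sym (withAdjacentColumns-right M i u u r)))

    unchanged : ∀ r s → withAdjacentColumns M i x y r s ≡ M r s
    unchanged r s =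
      ≡.trans (updateAt-id-local (inject₁ i) inner (≡.sym (inner-unchanged (inject₁ i))) s) (inner-unchanged s)
      where
      inner : Col
      inner = replaceColumn M (suc i) y r
      inner-unchanged : ∀ s → inner s ≡ M r s
      inner-unchanged = updateAt-id-local (suc i) (M r) ≡.refl

  det-equalColumns₀ : ∀ n (i : Fin n) (M : Mat (suc n)) →
                      (∀ r → M r zero ≈ M r (suc i)) → det F (suc n) M ≈ 0#
  det-equalColumns₀ (suc m) = <-weakInduction P (det-adjacentEqualColumns (suc m) zero) step
    where
    P : Fin (suc m) → Set (c ⊔ ℓ)
    P i = ∀ M → (∀ r → M r zero ≈ M r (suc i)) → det F (suc (suc m)) M ≈ 0#

    -- Swapping columns suc (inject₁ i) and suc (suc i) moves the copy of column 0 one step left.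
    step : ∀ i → P (inject₁ i) → P (suc i)
    step i ih M cols≈ = begin
      det F (suc (suc m)) M       ≈⟨ -‿involutive _ ⟨
      - - det F (suc (suc m)) M   ≈⟨ -‿cong (det-swapAdjacentColumns (suc m) (suc i) M) ⟨
      - det F (suc (suc m)) M′    ≈⟨ -‿cong (ih M′ λ r → trans (cols≈ r) (sym (reflexive (moved r)))) ⟩
      - 0#                        ≈⟨ -0#≈0# ⟩
      0#                          ∎
      where
      M′ : Mat (suc (suc m))
      M′ = swapAdjacentColumns M (suc i)

      moved : ∀ r → M′ r (suc (inject₁ i)) ≡ M r (suc (suc i))
      moved = withAdjacentColumns-left M (suc i) (column M (suc (suc i))) (column M (inject₁ (suc i)))

  det-addColumn₀Multiple : ∀ n (s : Fin n) t (M : Mat (suc n)) →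
    det F (suc n) (replaceColumn M (suc s) (λ r → M r (suc s) + M r zero * t)) ≈ det F (suc n) M
  det-addColumn₀Multiple n s t M = begin
    det F (suc n) P          ≈⟨ det-linear (suc n) (suc s) t Pₛ P≈Z P≈M ⟩
    t * det F (suc n) Z + det F (suc n) M
      ≈⟨ +-cong (*-cong refl (det-equalColumns₀ n s Z λ r → sym (reflexive (updateAt-updates (suc s) (M r)))))
                refl ⟩
    t * 0# + det F (suc n) M ≈⟨ solve 2 (λ t d → t :* con 0 :+ d := d) refl t (det F (suc n) M) ⟩
    det F (suc n) M          ∎
    where
    P Z : Mat (suc n)
    P = replaceColumn M (suc s) (λ r → M r (suc s) + M r zero * t)
    Z = replaceColumn M (suc s) (column M zero)

    Pₛ : ∀ r → P r (suc s) ≈ t * Z r (suc s) + M r (suc s)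
    Pₛ r = begin
      P r (suc s)                   ≡⟨ updateAt-updates (suc s) (M r) ⟩
      M r (suc s) + M r zero * t
        ≈⟨ solve 3 (λ x m t → x :+ m :* t := t :* m :+ x) refl (M r (suc s)) (M r zero) t ⟩
      t * M r zero + M r (suc s)
        ≡⟨ ≡.cong (λ z → t * z + M r (suc s)) (updateAt-updates (suc s) (M r)) ⟨
      t * Z r (suc s) + M r (suc s) ∎

    P≈M : ∀ r s′ → s′ ≢ suc s → P r s′ ≈ M r s′
    P≈M r s′ s′≢ = reflexive (updateAt-minimal s′ (suc s) (M r) s′≢)

    P≈Z : ∀ r s′ → s′ ≢ suc s → P r s′ ≈ Z r s′
    P≈Z r s′ s′≢ = trans (P≈M r s′ s′≢) (sym (reflexive (updateAt-minimal s′ (suc s) (M r) s′≢)))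

  addColumn₀Multiples : ∀ {n} → (Fin n → Carrier) → Mat (suc n) → Mat (suc n)
  addColumn₀Multiples b M r zero    = M r zero
  addColumn₀Multiples b M r (suc s) = M r (suc s) + M r zero * b s

  det-addColumn₀Multiples : ∀ n (b : Fin n → Carrier) (M : Mat (suc n)) →
                            det F (suc n) (addColumn₀Multiples b M) ≈ det F (suc n) M
  det-addColumn₀Multiples n b M =
    supportedBelow n ≤-refl b (λ s n≤s → contradiction n≤s (<⇒≱ (toℕ<n s)))
    where
    supportedBelow : ∀ t → t ≤ n → ∀ b → (∀ s → t ≤ toℕ s → b s ≈ 0#) →
                    det F (suc n) (addColumn₀Multiples b M) ≈ det F (suc n) M
    supportedBelow zero _ b b≈0 = det-cong (suc n) unchanged
      where
      unchanged : ∀ r s → addColumn₀Multiples b M r s ≈ M r s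
      unchanged r zero    = refl
      unchanged r (suc s) = trans (+-cong refl (trans (*-cong refl (b≈0 s z≤n)) (zeroʳ _))) (+-identityʳ _)
    supportedBelow (suc t) t<n b b≈0 = begin
      det F (suc n) (addColumn₀Multiples b M)     ≈⟨ det-cong (suc n) lastStep ⟩
      det F (suc n) (replaceColumn C (suc sₜ) (λ r → C r (suc sₜ) + C r zero * b sₜ))
                                                  ≈⟨ det-addColumn₀Multiple n sₜ (b sₜ) C ⟩
      det F (suc n) C                             ≈⟨ supportedBelow t (<⇒≤ t<n) b′ b′≈0 ⟩
      det F (suc n) M                             ∎
      where
      sₜ : Fin n
      sₜ = fromℕ< t<n

      b′ : Fin n → Carrier
      b′ = updateAt b sₜ (λ _ → 0#)

      C : Mat (suc n)
      C = addColumn₀Multiples b′ M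

      b′≈0 : ∀ s → t ≤ toℕ s → b′ s ≈ 0#
      b′≈0 s t≤s with s ≟ᶠ sₜ
      ... | yes ≡.refl = reflexive (updateAt-updates sₜ b)
      ... | no s≢sₜ = trans (reflexive (updateAt-minimal s sₜ b s≢sₜ)) (b≈0 s (≤∧≢⇒< t≤s t≢s))
        where
        t≢s : t ≢ toℕ s
        t≢s t≡s = s≢sₜ (toℕ-injective (≡.trans (≡.sym t≡s) (≡.sym (toℕ-fromℕ< t<n))))

      lastStep : ∀ r s → addColumn₀Multiples b M r s ≈
                         replaceColumn C (suc sₜ) (λ r → C r (suc sₜ) + C r zero * b sₜ) r s
      lastStep r zero = refl
      lastStep r (suc s) with s ≟ᶠ sₜ
      ... | yes ≡.refl = sym (begin
        replaceColumn C (suc sₜ) (λ r → C r (suc sₜ) + C r zero * b sₜ) r (suc sₜ)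
                                                            ≡⟨ updateAt-updates (suc sₜ) (C r) ⟩
        (M r (suc sₜ) + M r zero * b′ sₜ) + M r zero * b sₜ
          ≡⟨ ≡.cong (λ z → (M r (suc sₜ) + M r zero * z) + M r zero * b sₜ) (updateAt-updates sₜ b) ⟩
        (M r (suc sₜ) + M r zero * 0#) + M r zero * b sₜ
          ≈⟨ solve 3 (λ x m y → (x :+ m :* con 0) :+ m :* y := x :+ m :* y)
                   refl (M r (suc sₜ)) (M r zero) (b sₜ) ⟩
        M r (suc sₜ) + M r zero * b sₜ                   ∎)
      ... | no s≢sₜ = sym (reflexive (≡.trans
        (updateAt-minimal (suc s) (suc sₜ) (C r) (s≢sₜ ∘ suc-injective))
        (≡.cong (λ z → M r (suc s) + M r zero * z) (updateAt-minimal s sₜ b s≢sₜ))))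

  lowerRight : ∀ {n} → Mat (suc n) → Mat n
  lowerRight M r s = M (suc r) (suc s)

  rankOneUpdate : ∀ {n} → Mat (suc n) → Mat n
  rankOneUpdate M r s = M (suc r) (suc s) + M (suc r) zero * M zero (suc s)

  det-zeroBelowCorner : ∀ n (M : Mat (suc n)) → (∀ r → M (suc r) zero ≈ 0#) →
                        det F (suc n) M ≈ M zero zero * det F n (lowerRight M)
  det-zeroBelowCorner zero    M _        = ∑-head zero {expansionTerm M} (λ ())
  det-zeroBelowCorner (suc n) M below≈0 = ∑-head (suc n) {expansionTerm M} λ j →
    trans (signed-cong (suc j) (trans (*-cong refl (det-zeroColumn (suc n) zero (minor (suc j) M) below≈0))
                                      (zeroʳ _)))
          (signed-zero (suc j))

  det-zeroRightOfCorner : ∀ n (M : Mat (suc n)) → (∀ s → M zero (suc s) ≈ 0#) →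
                          det F (suc n) M ≈ M zero zero * det F n (lowerRight M)
  det-zeroRightOfCorner n M right≈0 = ∑-head n {expansionTerm M} λ j →
    trans (signed-cong (suc j) (trans (*-cong (right≈0 j) refl) (zeroˡ _))) (signed-zero (suc j))

  det-cornerExpansion : ∀ n (M : Mat (suc n)) →
    det F (suc n) M ≈ (M zero zero + 1#) * det F n (lowerRight M) - det F n (rankOneUpdate M)
  det-cornerExpansion n M = begin
    det F (suc n) M                  ≈⟨ det-additive (suc n) zero split off off ⟩
    det F (suc n) M₁ + det F (suc n) M₂
      ≈⟨ +-cong (det-zeroBelowCorner n M₁ (λ _ → refl)) det-M₂ ⟩
    (M zero zero + 1#) * det F n (lowerRight M) - det F n (rankOneUpdate M) ∎
    where
    M₁ M₂ : Mat (suc n)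
    M₁ = replaceColumn M zero λ { zero → M zero zero + 1# ; (suc r) → 0# }
    M₂ = replaceColumn M zero λ { zero → - 1# ; (suc r) → M (suc r) zero }

    split : ∀ r → M r zero ≈ M₁ r zero + M₂ r zero
    split zero    = sym (begin
      (M zero zero + 1#) + - 1#    ≈⟨ +-assoc _ _ _ ⟩
      M zero zero + (1# + - 1#)    ≈⟨ +-cong refl (-‿inverseʳ 1#) ⟩
      M zero zero + 0#             ≈⟨ +-identityʳ _ ⟩
      M zero zero                  ∎)
    split (suc r) = sym (+-identityˡ _)

    off : ∀ {x} r s → s ≢ zero → M r s ≈ replaceColumn M zero x r s
    off r zero    0≢0 = contradiction ≡.refl 0≢0
    off r (suc s) _   = refl

    det-M₂ : det F (suc n) M₂ ≈ - det F n (rankOneUpdate M)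
    det-M₂ = begin
      det F (suc n) M₂                   ≈⟨ det-addColumn₀Multiples n (λ s → M zero (suc s)) M₂ ⟨
      det F (suc n) C                    ≈⟨ det-zeroRightOfCorner n C firstRow≈0 ⟩
      - 1# * det F n (rankOneUpdate M)   ≈⟨ -1*x≈-x _ ⟩
      - det F n (rankOneUpdate M)        ∎
      where
      C : Mat (suc n)
      C = addColumn₀Multiples (λ s → M zero (suc s)) M₂

      firstRow≈0 : ∀ s → C zero (suc s) ≈ 0#
      firstRow≈0 s = trans (+-cong refl (-1*x≈-x _)) (-‿inverseʳ _)

module BlockTransposition {c ℓ : Level} (F : Field c ℓ) where
  open Field F hiding (zero)
  open Determinant F using (lowerRight; rankOneUpdate; det-cornerExpansion)
  open import Algebra.Properties.Ring ring using (-‿distribˡ-*)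
  open import Algebra.Solver.Ring.NaturalCoefficients.Default commutativeSemiring
  open import Algebra.Properties.CommutativeSemigroup *-commutativeSemigroup using (interchange)
  open import Relation.Binary.Reasoning.Setoid setoid

  record BlockTransposed {n} (X : Subset n) (M N : Matrix F n) : Set (c ⊔ ℓ) where
    field
      p q v w : Fin n → Carrier
      on-X×X   : ∀ r s → r ∈ X → s ∈ X → N r s ≈ M s r
      on-X̄×X̄   : ∀ r s → r ∉ X → s ∉ X → N r s ≈ M r s
      M-on-X×X̄ : ∀ r s → r ∈ X → s ∉ X → M r s ≈ p r * v s
      N-on-X×X̄ : ∀ r s → r ∈ X → s ∉ X → N r s ≈ q r * v s
      M-on-X̄×X : ∀ r s → r ∉ X → s ∈ X → M r s ≈ w r * q s
      N-on-X̄×X : ∀ r s → r ∉ X → s ∈ X → N r s ≈ w r * p s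

  open BlockTransposed

  private
    ↑∉ : ∀ {n} {x} {X : Subset n} {r} → r ∉ X → suc r ∉ x ∷ X
    ↑∉ r∉X = r∉X ∘ drop-there

    factorʳ : ∀ a m b c → a * c + m * (b * c) ≈ (a + b * m) * c
    factorʳ = solve 4 (λ a m b c → a :* c :+ m :* (b :* c) := (a :+ b :* m) :* c) refl

    factorˡ : ∀ a m b c → a * c + (a * b) * m ≈ a * (c + b * m)
    factorˡ = solve 4 (λ a m b c → a :* c :+ (a :* b) :* m := a :* (c :+ b :* m)) refl

    swap-outer : ∀ a b c d → (a * b) * (c * d) ≈ (d * b) * (c * a)
    swap-outer = solve 4 (λ a b c d → (a :* b) :* (c :* d) := (d :* b) :* (c :* a)) refl

  corner≈ : ∀ {n x} {X : Subset n} {M N} → BlockTransposed (x ∷ X) M N → N zero zero ≈ M zero zero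
  corner≈ {x = inside}  T = on-X×X T zero zero here here
  corner≈ {x = outside} T = on-X̄×X̄ T zero zero (λ ()) (λ ())

  lowerRight⁺ : ∀ {n x} {X : Subset n} {M N} → BlockTransposed (x ∷ X) M N →
                BlockTransposed X (lowerRight M) (lowerRight N)
  lowerRight⁺ T = record
    { p = p T ∘ suc ; q = q T ∘ suc ; v = v T ∘ suc ; w = w T ∘ suc
    ; on-X×X   = λ r s r∈ s∈ → on-X×X T (suc r) (suc s) (there r∈) (there s∈)
    ; on-X̄×X̄   = λ r s r∉ s∉ → on-X̄×X̄ T (suc r) (suc s) (↑∉ r∉) (↑∉ s∉)
    ; M-on-X×X̄ = λ r s r∈ s∉ → M-on-X×X̄ T (suc r) (suc s) (there r∈) (↑∉ s∉)
    ; N-on-X×X̄ = λ r s r∈ s∉ → N-on-X×X̄ T (suc r) (suc s) (there r∈) (↑∉ s∉)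
    ; M-on-X̄×X = λ r s r∉ s∈ → M-on-X̄×X T (suc r) (suc s) (↑∉ r∉) (there s∈)
    ; N-on-X̄×X = λ r s r∉ s∈ → N-on-X̄×X T (suc r) (suc s) (↑∉ r∉) (there s∈)
    }

  rankOneUpdate⁺-inside : ∀ {n} {X : Subset n} {M N} → BlockTransposed (inside ∷ X) M N →
                          BlockTransposed X (rankOneUpdate M) (rankOneUpdate N)
  rankOneUpdate⁺-inside {M = M} {N} T = record
    { p = λ r → p T (suc r) + p T zero * M (suc r) zero
    ; q = λ r → q T (suc r) + q T zero * N (suc r) zero
    ; v = v T ∘ suc
    ; w = w T ∘ suc
    ; on-X×X   = λ r s r∈ s∈ → +-cong (on-X×X T (suc r) (suc s) (there r∈) (there s∈))
        (trans (*-cong (on-X×X T (suc r) zero (there r∈) here) (on-X×X T zero (suc s) here (there s∈))) (*-comm _ _))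
    ; on-X̄×X̄   = λ r s r∉ s∉ → +-cong (on-X̄×X̄ T (suc r) (suc s) (↑∉ r∉) (↑∉ s∉)) (begin
        N (suc r) zero * N zero (suc s)
          ≈⟨ *-cong (N-on-X̄×X T (suc r) zero (↑∉ r∉) here) (N-on-X×X̄ T zero (suc s) here (↑∉ s∉)) ⟩
        (w T (suc r) * p T zero) * (q T zero * v T (suc s))  ≈⟨ interchange _ _ _ _ ⟩
        (w T (suc r) * q T zero) * (p T zero * v T (suc s))
          ≈⟨ *-cong (M-on-X̄×X T (suc r) zero (↑∉ r∉) here) (M-on-X×X̄ T zero (suc s) here (↑∉ s∉)) ⟨
        M (suc r) zero * M zero (suc s) ∎)
    ; M-on-X×X̄ = λ r s r∈ s∉ → trans
        (+-cong (M-on-X×X̄ T (suc r) (suc s) (there r∈) (↑∉ s∉)) (*-cong refl (M-on-X×X̄ T zero (suc s) here (↑∉ s∉))))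
        (factorʳ _ _ _ _)
    ; N-on-X×X̄ = λ r s r∈ s∉ → trans
        (+-cong (N-on-X×X̄ T (suc r) (suc s) (there r∈) (↑∉ s∉)) (*-cong refl (N-on-X×X̄ T zero (suc s) here (↑∉ s∉))))
        (factorʳ _ _ _ _)
    ; M-on-X̄×X = λ r s r∉ s∈ → trans
        (+-cong (M-on-X̄×X T (suc r) (suc s) (↑∉ r∉) (there s∈))
                (*-cong (M-on-X̄×X T (suc r) zero (↑∉ r∉) here) (sym (on-X×X T (suc s) zero (there s∈) here))))
        (factorˡ _ _ _ _)
    ; N-on-X̄×X = λ r s r∉ s∈ → trans
        (+-cong (N-on-X̄×X T (suc r) (suc s) (↑∉ r∉) (there s∈))
                (*-cong (N-on-X̄×X T (suc r) zero (↑∉ r∉) here) (on-X×X T zero (suc s) here (there s∈))))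
        (factorˡ _ _ _ _)
    }

  rankOneUpdate⁺-outside : ∀ {n} {X : Subset n} {M N} → BlockTransposed (outside ∷ X) M N →
                           BlockTransposed X (rankOneUpdate M) (rankOneUpdate N)
  rankOneUpdate⁺-outside {M = M} {N} T = record
    { p = p T ∘ suc
    ; q = q T ∘ suc
    ; v = λ s → v T (suc s) + v T zero * M zero (suc s)
    ; w = λ r → w T (suc r) + w T zero * M (suc r) zero
    ; on-X×X   = λ r s r∈ s∈ → +-cong (on-X×X T (suc r) (suc s) (there r∈) (there s∈)) (begin
        N (suc r) zero * N zero (suc s)
          ≈⟨ *-cong (N-on-X×X̄ T (suc r) zero (there r∈) (λ ())) (N-on-X̄×X T zero (suc s) (λ ()) (there s∈)) ⟩
        (q T (suc r) * v T zero) * (w T zero * p T (suc s))  ≈⟨ swap-outer _ _ _ _ ⟩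
        (p T (suc s) * v T zero) * (w T zero * q T (suc r))
          ≈⟨ *-cong (M-on-X×X̄ T (suc s) zero (there s∈) (λ ())) (M-on-X̄×X T zero (suc r) (λ ()) (there r∈)) ⟨
        M (suc s) zero * M zero (suc r) ∎)
    ; on-X̄×X̄   = λ r s r∉ s∉ → +-cong (on-X̄×X̄ T (suc r) (suc s) (↑∉ r∉) (↑∉ s∉))
        (*-cong (on-X̄×X̄ T (suc r) zero (↑∉ r∉) (λ ())) (on-X̄×X̄ T zero (suc s) (λ ()) (↑∉ s∉)))
    ; M-on-X×X̄ = λ r s r∈ s∉ → trans
        (+-cong (M-on-X×X̄ T (suc r) (suc s) (there r∈) (↑∉ s∉)) (*-cong (M-on-X×X̄ T (suc r) zero (there r∈) (λ ())) refl))
        (factorˡ _ _ _ _)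
    ; N-on-X×X̄ = λ r s r∈ s∉ → trans
        (+-cong (N-on-X×X̄ T (suc r) (suc s) (there r∈) (↑∉ s∉))
                (*-cong (N-on-X×X̄ T (suc r) zero (there r∈) (λ ())) (on-X̄×X̄ T zero (suc s) (λ ()) (↑∉ s∉))))
        (factorˡ _ _ _ _)
    ; M-on-X̄×X = λ r s r∉ s∈ → trans
        (+-cong (M-on-X̄×X T (suc r) (suc s) (↑∉ r∉) (there s∈)) (*-cong refl (M-on-X̄×X T zero (suc s) (λ ()) (there s∈))))
        (factorʳ _ _ _ _)
    ; N-on-X̄×X = λ r s r∉ s∈ → trans
        (+-cong (N-on-X̄×X T (suc r) (suc s) (↑∉ r∉) (there s∈))
                (*-cong (on-X̄×X̄ T (suc r) zero (↑∉ r∉) (λ ())) (N-on-X̄×X T zero (suc s) (λ ()) (there s∈))))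
        (factorʳ _ _ _ _)
    }

  rankOneUpdate⁺ : ∀ {n x} {X : Subset n} {M N} → BlockTransposed (x ∷ X) M N →
                   BlockTransposed X (rankOneUpdate M) (rankOneUpdate N)
  rankOneUpdate⁺ {x = inside}  = rankOneUpdate⁺-inside
  rankOneUpdate⁺ {x = outside} = rankOneUpdate⁺-outside

  det-blockTransposed : ∀ n {X : Subset n} {M N} → BlockTransposed X M N → det F n N ≈ det F n M
  det-blockTransposed zero    _ = refl
  det-blockTransposed (suc n) {_ ∷ _} {M} {N} T = begin
    det F (suc n) N
      ≈⟨ det-cornerExpansion n N ⟩
    (N zero zero + 1#) * det F n (lowerRight N) - det F n (rankOneUpdate N)
      ≈⟨ +-cong (*-cong (+-cong (corner≈ T) refl) (det-blockTransposed n (lowerRight⁺ T)))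
                (-‿cong (det-blockTransposed n (rankOneUpdate⁺ T))) ⟩
    (M zero zero + 1#) * det F n (lowerRight M) - det F n (rankOneUpdate M)
      ≈⟨ det-cornerExpansion n M ⟨
    det F (suc n) M ∎

  module _ {n} {X : Subset n} (A : Matrix F n) where

    Inv-X×X : ∀ {r s} → r ∈ X → s ∈ X → Inv F X A r s ≡ - A r s
    Inv-X×X r∈X s∈X rewrite []=⇒lookup r∈X | []=⇒lookup s∈X = ≡.refl

    Inv-X̄-row : ∀ {r s} → r ∉ X → Inv F X A r s ≡ A r s
    Inv-X̄-row r∉X rewrite lookup-∉ r∉X = ≡.refl

    Inv-X̄-column : ∀ {r s} → s ∉ X → Inv F X A r s ≡ A r s
    Inv-X̄-column {r} s∉X rewrite lookup-∉ s∉X | ∧-zeroʳ (lookup X r) = ≡.refl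

  Inv-blockTransposed : ∀ {n} (X : Subset n) {A : Matrix F n} → SkewSymmetric F A →
                        RankAtMostOne F A (_∈ X) (_∉ X) → BlockTransposed X A (Inv F X A)
  Inv-blockTransposed X {A} skew (u , v , A-on-X×X̄) = record
    { p = u ; q = u ; v = v ; w = λ r → - v r
    ; on-X×X   = λ r s r∈ s∈ → trans (reflexive (Inv-X×X A r∈ s∈)) (sym (skew r s))
    ; on-X̄×X̄   = λ r s r∉ _ → reflexive (Inv-X̄-row A r∉)
    ; M-on-X×X̄ = A-on-X×X̄
    ; N-on-X×X̄ = λ r s r∈ s∉ → trans (reflexive (Inv-X̄-column A s∉)) (A-on-X×X̄ r s r∈ s∉)
    ; M-on-X̄×X = A-on-X̄×X
    ; N-on-X̄×X = λ r s r∉ s∈ → trans (reflexive (Inv-X̄-row A r∉)) (A-on-X̄×X r s r∉ s∈)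
    }
    where
    A-on-X̄×X : ∀ r s → r ∉ X → s ∈ X → A r s ≈ - v r * u s
    A-on-X̄×X r s r∉ s∈ = begin
      A r s          ≈⟨ skew s r ⟩
      - A s r        ≈⟨ -‿cong (A-on-X×X̄ s r s∈ r∉) ⟩
      - (u s * v r)  ≈⟨ -‿cong (*-comm _ _) ⟩
      - (v r * u s)  ≈⟨ -‿distribˡ-* _ _ ⟩
      - v r * u s    ∎

open BlockTransposition using (det-blockTransposed; Inv-blockTransposed)

proposition2p6 : ∀ {c ℓ : Level} (F : Field c ℓ) (n : ℕ) (A : Matrix F n) (X : Subset n) →
    SkewSymmetric F A → HLClan F A X →
    Field._≈_ F (det F n (Inv F X A)) (det F n A)
-- Skew-symmetry recovers A[X̄,X] from A[X,X̄].
proposition2p6 F n A X skew (upper , _) = det-blockTransposed F n (Inv-blockTransposed F X skew upper)
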